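{- Let $N$ be an RPN over $X$, let $\tau$ be an exposed tree-node component of $N$, and let $u$ be a tree node in $\tau$. Then for every $S\subseteq X$, $S$ is displayed (as a softwired cluster) at $u$ in $N$ if and only if both of the following hold: (i) every leaf $\ell\in S$ is below $u$ in $N$, and (ii) every leaf $\ell\notin S$ is not dominated by $u$ in $N$.
   Context: An RPN over a finite set $X$ of taxa is a finite acyclic directed graph $N$ with a unique node of indegree $0$ (the root, which has outdegree at least $1$), all edges directed away from the root, such that every non-root node has indegree $1$ or outdegree $1$, and the nodes of indegree $1$ and outdegree $0$ (leaves) are bijectively labelled by $X$ (leaves are identified with their labels). A non-leaf node of indegree at least $2$ (and outdegree $1$) is a reticulate node; a tree node is the root or a node of indegree $1$ and outdegree at least $2$; a redundant node has indegree $1$ and outdegree $1$. A node $v$ is below $u$ if there is a directed path from $u$ to $v$. $u$ dominates (is a dominator of) $v$ if $u$ is an ancestor of $v$ and every directed path from the root to $v$ contains $u$. Tree-node components are the connected components of the subgraph induced by the tree nodes. A reticulate node is isolated if neither any of its parents nor its child is a reticulate node. A tree-node component $\tau$ is exposed if every node that is below some node of $\tau$ and not in $\tau$ is a leaf, an isolated reticulate node, or a redundant node. A set $S\subseteq X$ is displayed at a node $u$ if there is a spanning tree $T$ of $N$ (a subgraph containing all nodes that is a rooted tree at the root of $N$) such that the set of leaves of $N$ that are below $u$ in $T$ is exactly $S$ (leaves of $T$ that are not leaves of $N$ are not counted). -}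

module Defs where

open import Data.Nat using (ℕ; _≤_; _≥_)
open import Data.Fin using (Fin)
open import Data.Fin.Subset using (Subset; _∈_; _∉_)
open import Data.Bool using (Bool; true; false)
open import Data.List using (List; length; filterᵇ; allFin)
open import Data.Product using (Σ; _×_; _,_)
open import Data.Sum using (_⊎_)
open import Data.Empty using (⊥)
open import Relation.Nullary using (¬_)
open import Relation.Binary.PropositionalEquality using (_≡_)

Digraph : ℕ → Set
Digraph n = Fin n → Fin n → Bool

module _ {n : ℕ} (E : Digraph n) where

  Edge : Fin n → Fin n → Set
  Edge u v = E u v ≡ true

  indeg : Fin n → ℕ
  indeg v = length (filterᵇ (λ u → E u v) (allFin n))

  outdeg : Fin n → ℕ
  outdeg u = length (filterᵇ (λ v → E u v) (allFin n))

  data Path : Fin n → Fin n → Set where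
    here : ∀ {v} → Path v v
    step : ∀ {u w v} → Edge u w → Path w v → Path u v

  Visits : ∀ {a b} → Path a b → Fin n → Set
  Visits (here {v}) x = x ≡ v
  Visits (step {u} _ p) x = x ≡ u ⊎ Visits p x

  Acyclic : Set
  Acyclic = ∀ u w → Edge u w → Path w u → ⊥

record RPN (m : ℕ) : Set where
  field
    n      : ℕ
    E      : Digraph n
    root   : Fin n
    label  : Fin m → Fin n
    acyclic      : Acyclic E
    root-indeg   : indeg E root ≡ 0
    root-outdeg  : outdeg E root ≥ 1
    root-unique  : ∀ v → indeg E v ≡ 0 → v ≡ root
    nonroot-deg  : ∀ v → ¬ (v ≡ root) → indeg E v ≡ 1 ⊎ outdeg E v ≡ 1
    label-inj    : ∀ x y → label x ≡ label y → x ≡ y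
    label-leaf   : ∀ x → indeg E (label x) ≡ 1 × outdeg E (label x) ≡ 0
    leaf-label   : ∀ v → indeg E v ≡ 1 → outdeg E v ≡ 0 → Σ (Fin m) (λ x → label x ≡ v)

module _ {m : ℕ} (N : RPN m) where
  open RPN N

  IsLeaf : Fin n → Set
  IsLeaf v = indeg E v ≡ 1 × outdeg E v ≡ 0

  IsReticulate : Fin n → Set
  IsReticulate v = ¬ IsLeaf v × indeg E v ≥ 2 × outdeg E v ≡ 1

  IsTreeNode : Fin n → Set
  IsTreeNode v = v ≡ root ⊎ (indeg E v ≡ 1 × outdeg E v ≥ 2)

  IsRedundant : Fin n → Set
  IsRedundant v = indeg E v ≡ 1 × outdeg E v ≡ 1

  Below : Fin n → Fin n → Set
  Below u v = Path E u v

  Dominates : Fin n → Fin n → Set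
  Dominates u v = Path E u v × ((p : Path E root v) → Visits E p u)

  IsolatedReticulate : Fin n → Set
  IsolatedReticulate v =
    IsReticulate v
    × (∀ p → Edge E p v → ¬ IsReticulate p)
    × (∀ c → Edge E v c → ¬ IsReticulate c)

  -- a and b lie in the same tree-node component: connected in the
  -- undirected graph underlying the subgraph induced by the tree nodes
  data SameComp : Fin n → Fin n → Set where
    sc-refl : ∀ {a} → IsTreeNode a → SameComp a a
    sc-step : ∀ {a c b} → IsTreeNode a → IsTreeNode c →
              (Edge E a c ⊎ Edge E c a) → SameComp c b → SameComp a b

  -- the tree-node component τ = {t | SameComp u t} (of a tree node u) is exposed
  ExposedComponentOf : Fin n → Set
  ExposedComponentOf u =
    ∀ t w → SameComp u t → Below t w → ¬ SameComp u w →
      IsLeaf w ⊎ IsolatedReticulate w ⊎ IsRedundant w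

  record SpanningTree : Set where
    field
      T        : Digraph n
      T⊆E      : ∀ a b → Edge T a b → Edge E a b
      T-reach  : ∀ v → Path T root v
      T-indeg  : ∀ v → ¬ (v ≡ root) → indeg T v ≡ 1

  DisplayedAt : Subset m → Fin n → Set
  DisplayedAt S u =
    Σ SpanningTree λ sp →
      ∀ x → (x ∈ S → Path (SpanningTree.T sp) u (label x))
          × (Path (SpanningTree.T sp) u (label x) → x ∈ S)

-- Necessity holds for any node u and is read off the displaying spanning tree.
-- For sufficiency call a node avoidable if the root reaches it avoiding u.  Tree
-- nodes have a single parent, so a tree-node component is a rooted tree, and hence
-- an avoidable descendant of u lies outside u's component; by exposure it and all
-- its descendants have out-degree at most 1, so it lies above at most one leaf.
-- The spanning tree is given by a parent choice: a node below u and above a leaf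
-- of S takes a parent below u, any other avoidable node an avoidable parent.
-- Climbing from a leaf of S then reaches u.  Conversely, along a tree path from u
-- to a leaf outside S avoidability propagates up to u, which is absurd, so that
-- leaf is dominated by u, contradicting (ii).
module Submission where

open import Defs
open import Data.Bool using (Bool; true; false; T?)
open import Data.Bool.Properties using (T-≡) renaming (_≟_ to _≟ᵇ_)
open import Data.Empty using (⊥; ⊥-elim)
open import Data.Fin using (Fin; zero; suc)
open import Data.Fin.Properties using (_≟_; any?; injective⇒≤)
open import Data.Fin.Subset using (Subset; _∈_; _∉_)
open import Data.Fin.Subset.Properties using (_∈?_)
open import Data.List using (List; []; _∷_; length; filterᵇ; allFin)
open import Data.List.Properties using (filter-none)
open import Data.List.Membership.Propositional using () renaming (_∈_ to _∈ₗ_)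
open import Data.List.Membership.Propositional.Properties using (∈-filter⁺; ∈-filter⁻; ∈-allFin; ∈-length)
open import Data.List.Relation.Unary.All using (_∷_)
open import Data.List.Relation.Unary.AllPairs using (_∷_)
open import Data.List.Relation.Unary.All.Properties using () renaming (tabulate⁺ to All-tabulate⁺)
open import Data.List.Relation.Unary.Any using (here; there)
open import Data.List.Relation.Unary.Unique.Propositional using (Unique)
open import Data.List.Relation.Unary.Unique.Propositional.Properties using (filter⁺; allFin⁺)
open import Data.Nat using (ℕ; zero; suc; _≤_; _<_; z≤n; s≤s)
open import Data.Nat.Properties using (<-irrefl; <⇒≤; ≤-reflexive)
open import Data.Product using (Σ-syntax; _×_; _,_; proj₁; proj₂)
open import Data.Sum using (_⊎_; inj₁; inj₂; [_,_])
open import Function using (_∘_)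
open import Function.Bundles using (_⇔_; mk⇔; Equivalence)
open import Relation.Nullary using (¬_; Dec; yes; no; does; proof)
open import Relation.Nullary.Reflects using (Reflects; invert)
open import Relation.Nullary.Decidable using (_×-dec_; ¬?; map′; dec-true)
open import Relation.Binary.PropositionalEquality using (_≡_; _≢_; refl; sym; trans; cong; subst)

∈-length≤1 : ∀ {A : Set} {xs : List A} {a b} → length xs ≤ 1 → a ∈ₗ xs → b ∈ₗ xs → a ≡ b
∈-length≤1 {xs = _ ∷ []} _ (here a≡x) (here b≡x) = trans a≡x (sym b≡x)
∈-length≤1 {xs = _ ∷ _ ∷ _} (s≤s ()) _ _

unique-constant⇒length1 : ∀ {A : Set} {xs : List A} {a} →
  Unique xs → a ∈ₗ xs → (∀ {b} → b ∈ₗ xs → b ≡ a) → length xs ≡ 1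
unique-constant⇒length1 {xs = _ ∷ []} _ _ _ = refl
unique-constant⇒length1 {xs = _ ∷ _ ∷ _} ((x≢y ∷ _) ∷ _) _ all-a =
  ⊥-elim (x≢y (trans (all-a (here refl)) (sym (all-a (there (here refl))))))

count : ∀ {n} → (Fin n → Bool) → ℕ
count {n} p = length (filterᵇ p (allFin n))

module _ {n : ℕ} (p : Fin n → Bool) where

  private
    selected⁺ : ∀ {a} → p a ≡ true → a ∈ₗ filterᵇ p (allFin n)
    selected⁺ {a} pa = ∈-filter⁺ (T? ∘ p) (∈-allFin a) (Equivalence.from T-≡ pa)

    selected⁻ : ∀ {a} → a ∈ₗ filterᵇ p (allFin n) → p a ≡ true
    selected⁻ a∈ = Equivalence.to T-≡ (proj₂ (∈-filter⁻ (T? ∘ p) {xs = allFin n} a∈))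

  count-zero : count p ≡ 0 → ∀ a → p a ≡ true → ⊥
  count-zero c a pa = <-irrefl (sym c) (∈-length (selected⁺ pa))

  count-none : (∀ a → p a ≢ true) → count p ≡ 0
  count-none none =
    cong length (filter-none (T? ∘ p) (All-tabulate⁺ (λ a → none a ∘ Equivalence.to T-≡)))

  count≤1-unique : count p ≤ 1 → ∀ {a b} → p a ≡ true → p b ≡ true → a ≡ b
  count≤1-unique c pa pb = ∈-length≤1 c (selected⁺ pa) (selected⁺ pb)

  count-one : ∀ {a} → p a ≡ true → (∀ {b} → p b ≡ true → b ≡ a) → count p ≡ 1
  count-one pa only-a =
    unique-constant⇒length1 (filter⁺ (T? ∘ p) (allFin⁺ n)) (selected⁺ pa) (only-a ∘ selected⁻)

module _ {n : ℕ} {G : Digraph n} where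

  _++ₚ_ : ∀ {a b c} → Path G a b → Path G b c → Path G a c
  here ++ₚ q = q
  step e p ++ₚ q = step e (p ++ₚ q)

  snoc : ∀ {a b c} → Path G a b → Edge G b c → Path G a c
  snoc p e = p ++ₚ step e here

  pathLength : ∀ {a b} → Path G a b → ℕ
  pathLength here = 0
  pathLength (step _ p) = suc (pathLength p)

  pathLength-snoc : ∀ {a b c} (p : Path G a b) (e : Edge G b c) →
    pathLength (snoc p e) ≡ suc (pathLength p)
  pathLength-snoc here e = refl
  pathLength-snoc (step _ p) e = cong suc (pathLength-snoc p e)

  visits-start : ∀ {a b} (p : Path G a b) → Visits G p a
  visits-start here = refl
  visits-start (step _ _) = inj₁ refl

  visits-end : ∀ {a b} (p : Path G a b) → Visits G p b
  visits-end here = refl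
  visits-end (step _ p) = inj₂ (visits-end p)

  visits-++ : ∀ {a b c y} (p : Path G a b) (q : Path G b c) →
    Visits G (p ++ₚ q) y → Visits G p y ⊎ Visits G q y
  visits-++ here q v = inj₂ v
  visits-++ (step _ p) q (inj₁ eq) = inj₁ (inj₁ eq)
  visits-++ (step _ p) q (inj₂ v) with visits-++ p q v
  ... | inj₁ vp = inj₁ (inj₂ vp)
  ... | inj₂ vq = inj₂ vq

  prefix : ∀ {a b y} (p : Path G a b) → Visits G p y → Path G a y
  prefix here refl = here
  prefix (step _ _) (inj₁ refl) = here
  prefix (step e p) (inj₂ v) = step e (prefix p v)

  suffix : ∀ {a b y} (p : Path G a b) → Visits G p y → Path G y b
  suffix here refl = here
  suffix (step e p) (inj₁ refl) = step e p
  suffix (step _ p) (inj₂ v) = suffix p v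

  AllOn : (Fin n → Set) → ∀ {a b} → Path G a b → Set
  AllOn P p = ∀ {y} → Visits G p y → P y

  lastEdge : ∀ {a b} (p : Path G a b) → a ≡ b ⊎
    Σ[ q ∈ Fin n ] Σ[ p′ ∈ Path G a q ] Edge G q b × (∀ {y} → Visits G p′ y → Visits G p y)
  lastEdge here = inj₁ refl
  lastEdge (step e p) with lastEdge p
  ... | inj₁ refl = inj₂ (_ , here , e , inj₁)
  ... | inj₂ (q , p′ , e′ , sub) =
        inj₂ (q , step e p′ , e′ , λ { (inj₁ eq) → inj₁ eq ; (inj₂ v) → inj₂ (sub v) })

  predecessor-on : ∀ {a b x} (p : Path G a b) → Visits G p x → x ≢ a →
    Σ[ r ∈ Fin n ] Visits G p r × Edge G r x
  predecessor-on here refl x≢a = ⊥-elim (x≢a refl)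
  predecessor-on (step _ _) (inj₁ x≡a) x≢a = ⊥-elim (x≢a x≡a)
  predecessor-on {x = x} (step {w = w} e p) (inj₂ v) _ with x ≟ w
  ... | yes refl = _ , inj₁ refl , e
  ... | no x≢w with predecessor-on p v x≢w
  ...   | r , vr , er = r , inj₂ vr , er

  mapPath : ∀ {H : Digraph n} → (∀ {a b} → Edge G a b → Edge H a b) → ∀ {a b} → Path G a b → Path H a b
  mapPath f here = here
  mapPath f (step e p) = step (f e) (mapPath f p)

  visits-mapPath : ∀ {H : Digraph n} (f : ∀ {a b} → Edge G a b → Edge H a b) {a b y} (p : Path G a b) →
    Visits H (mapPath f p) y → Visits G p y
  visits-mapPath f here v = v
  visits-mapPath f (step _ _) (inj₁ eq) = inj₁ eq
  visits-mapPath f (step _ p) (inj₂ v) = inj₂ (visits-mapPath f p v)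

  visits? : ∀ {a b} (p : Path G a b) x → Dec (Visits G p x)
  visits? here x = x ≟ _
  visits? (step _ p) x with x ≟ _ | visits? p x
  ... | yes eq | _ = yes (inj₁ eq)
  ... | no _ | yes v = yes (inj₂ v)
  ... | no ¬eq | no ¬v = no λ { (inj₁ eq) → ¬eq eq ; (inj₂ v) → ¬v v }

  module _ (acyclic : Acyclic G) where

    acyclic-antisym : ∀ {a b} → Path G a b → Path G b a → a ≡ b
    acyclic-antisym here _ = refl
    acyclic-antisym (step e p) q = ⊥-elim (acyclic _ _ e (p ++ₚ q))

    -- The nodes of a path are pairwise distinct, so a path has fewer than n edges.
    private
      nodeAt : ∀ {a b} (p : Path G a b) → Fin (suc (pathLength p)) → Fin n
      nodeAt {a} p zero = a
      nodeAt (step _ p) (suc i) = nodeAt p i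

      prefixTo : ∀ {a b} (p : Path G a b) i → Path G a (nodeAt p i)
      prefixTo p zero = here
      prefixTo (step e p) (suc i) = step e (prefixTo p i)

      nodeAt-injective : ∀ {a b} (p : Path G a b) {i j} → nodeAt p i ≡ nodeAt p j → i ≡ j
      nodeAt-injective p {zero} {zero} _ = refl
      nodeAt-injective (step e p) {zero} {suc j} eq =
        ⊥-elim (acyclic _ _ e (subst (Path G _) (sym eq) (prefixTo p j)))
      nodeAt-injective (step e p) {suc i} {zero} eq =
        ⊥-elim (acyclic _ _ e (subst (Path G _) eq (prefixTo p i)))
      nodeAt-injective (step e p) {suc i} {suc j} eq = cong suc (nodeAt-injective p eq)

    pathLength<n : ∀ {a b} (p : Path G a b) → pathLength p < n
    pathLength<n p = injective⇒≤ (nodeAt-injective p)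

-- Reachability is decidable: search paths of at most k edges, and k = n suffices
-- in an acyclic graph.
pathWithin? : ∀ {n} (G : Digraph n) k a b → Dec (Σ[ p ∈ Path G a b ] pathLength p ≤ k)
pathWithin? G zero a b with a ≟ b
... | yes refl = yes (here , z≤n)
... | no a≢b = no λ { (here , _) → a≢b refl ; (step _ _ , ()) }
pathWithin? G (suc k) a b with a ≟ b
... | yes refl = yes (here , z≤n)
... | no a≢b with any? (λ c → (G a c ≟ᵇ true) ×-dec pathWithin? G k c b)
...   | yes (c , e , p , ≤k) = yes (step e p , s≤s ≤k)
...   | no none = no λ { (here , _) → a≢b refl ; (step e p , s≤s ≤k) → none (_ , e , p , ≤k) }

path? : ∀ {n} (G : Digraph n) → Acyclic G → ∀ a b → Dec (Path G a b)
path? {n} G acyclic a b =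
  map′ proj₁ (λ p → p , <⇒≤ (pathLength<n acyclic p)) (pathWithin? G n a b)

AvoidingPath : ∀ {n} → Digraph n → Fin n → Fin n → Fin n → Set
AvoidingPath G x a b = Σ[ p ∈ Path G a b ] ¬ Visits G p x

_∖_ : ∀ {n} → Digraph n → Fin n → Digraph n
(G ∖ x) a b with a ≟ x | b ≟ x
... | no _ | no _ = G a b
... | _    | _    = false

module _ {n : ℕ} {G : Digraph n} {x : Fin n} where

  ∖-edge⁻ : ∀ {a b} → Edge (G ∖ x) a b → Edge G a b × b ≢ x
  ∖-edge⁻ {a} {b} e with a ≟ x | b ≟ x
  ∖-edge⁻ () | yes _ | _
  ∖-edge⁻ () | no _  | yes _
  ... | no _ | no b≢x = e , b≢x

  ∖-edge⁺ : ∀ {a b} → Edge G a b → a ≢ x → b ≢ x → Edge (G ∖ x) a b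
  ∖-edge⁺ {a} {b} e a≢x b≢x with a ≟ x | b ≟ x
  ... | yes a≡x | _        = ⊥-elim (a≢x a≡x)
  ... | no _    | yes b≡x  = ⊥-elim (b≢x b≡x)
  ... | no _    | no _     = e

  toDeleted : ∀ {a b} (p : Path G a b) → ¬ Visits G p x → Path (G ∖ x) a b
  toDeleted here _ = here
  toDeleted (step e p) ¬v =
    step (∖-edge⁺ e (λ eq → ¬v (inj₁ (sym eq))) (λ eq → ¬v (inj₂ (subst (Visits G p) eq (visits-start p)))))
         (toDeleted p (¬v ∘ inj₂))

  fromDeleted : ∀ {a b} → Path (G ∖ x) a b → a ≢ x → AvoidingPath G x a b
  fromDeleted here a≢x = here , λ eq → a≢x (sym eq)
  fromDeleted (step e p) a≢x with ∖-edge⁻ e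
  ... | e′ , w≢x with fromDeleted p w≢x
  ...   | p′ , ¬v = step e′ p′ , λ { (inj₁ eq) → a≢x (sym eq) ; (inj₂ v) → ¬v v }

avoiding? : ∀ {n} (G : Digraph n) → Acyclic G → ∀ x a b → Dec (AvoidingPath G x a b)
avoiding? G acyclic x a b with a ≟ x
... | yes refl = no λ (p , ¬v) → ¬v (visits-start p)
... | no a≢x = map′ (λ p → fromDeleted p a≢x) (λ (p , ¬v) → toDeleted p ¬v)
                    (path? (G ∖ x) acyclic∖x a b)
  where
  acyclic∖x : Acyclic (G ∖ x)
  acyclic∖x a b e p = acyclic a b (edge e) (mapPath edge p)
    where
    edge : ∀ {c d} → Edge (G ∖ x) c d → Edge G c d
    edge e′ = proj₁ (∖-edge⁻ {G = G} {x = x} e′)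

-- If every node reachable from w has out-degree at most 1, the way down from w
-- is forced, so w reaches at most one sink.
sink-unique : ∀ {n} {G : Digraph n} {w a b} → (∀ {d} → Path G w d → outdeg G d ≤ 1) →
  Path G w a → Path G w b → outdeg G a ≡ 0 → outdeg G b ≡ 0 → a ≡ b
sink-unique thin here here _ _ = refl
sink-unique {G = G} {w} thin here (step e _) w-sink _ = ⊥-elim (count-zero (G w) w-sink _ e)
sink-unique {G = G} {w} thin (step e _) here _ w-sink = ⊥-elim (count-zero (G w) w-sink _ e)
sink-unique {G = G} {w} thin (step e p) (step e′ q) a-sink b-sink
  with count≤1-unique (G w) (thin here) e e′
... | refl = sink-unique (λ r → thin (step e r)) p q a-sink b-sink

module NetworkFacts {m : ℕ} (N : RPN m) where
  open RPN N

  no-edge-into-root : ∀ {a} → Edge E a root → ⊥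
  no-edge-into-root e = count-zero (λ a → E a root) root-indeg _ e

  path-into-root : ∀ {a} → Path E a root → a ≡ root
  path-into-root here = refl
  path-into-root (step e p) with path-into-root p
  ... | refl = ⊥-elim (no-edge-into-root e)

  -- every other node has a parent (the root is the only node of indegree 0)
  has-parent : ∀ {v} → v ≢ root → Σ[ p ∈ Fin n ] Edge E p v
  has-parent {v} v≢root with any? (λ p → E p v ≟ᵇ true)
  ... | yes found = found
  ... | no none = ⊥-elim (v≢root (root-unique v (count-none _ (λ a e → none (a , e)))))

  tree-node-parent-unique : ∀ {a b x} → IsTreeNode N x → Edge E a x → Edge E b x → a ≡ b
  tree-node-parent-unique (inj₁ refl) e _ = ⊥-elim (no-edge-into-root e)
  tree-node-parent-unique (inj₂ (indeg≡1 , _)) ea eb = count≤1-unique _ (≤-reflexive indeg≡1) ea eb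

  TreePath : Fin n → Fin n → Set
  TreePath t x = Σ[ p ∈ Path E t x ] AllOn (IsTreeNode N) p

  -- Since tree nodes have at most one parent, a tree-node component is a rooted
  -- tree: any two of its nodes are reached by tree paths from a common node.
  common-top : ∀ {a b} → SameComp N a b → Σ[ t ∈ Fin n ] TreePath t a × TreePath t b
  common-top (sc-refl ta) = _ , (here , λ { refl → ta }) , (here , λ { refl → ta })
  common-top (sc-step ta tc (inj₂ c→a) rest) with common-top rest
  ... | t , (πc , πc-tree) , πb = t , (snoc πc c→a , snoc-tree) , πb
    where
    snoc-tree : AllOn (IsTreeNode N) (snoc πc c→a)
    snoc-tree v with visits-++ πc (step c→a here) v
    ... | inj₁ v∈πc = πc-tree v∈πc
    ... | inj₂ (inj₁ refl) = tc
    ... | inj₂ (inj₂ refl) = ta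
  common-top (sc-step ta tc (inj₁ a→c) rest) with common-top rest
  ... | t , (πc , πc-tree) , (πb , πb-tree) with lastEdge πc
  ...   | inj₁ refl = _ , (here , λ { refl → ta }) ,
                      (step a→c πb , λ { (inj₁ refl) → ta ; (inj₂ v) → πb-tree v })
  ...   | inj₂ (q , πq , q→c , sub) with tree-node-parent-unique tc q→c a→c
  ...     | refl = t , (πq , λ v → πc-tree (sub v)) , (πb , πb-tree)

  -- A path ρ into the end of a tree path π meets each node y of π, unless ρ starts
  -- on π below y: read backwards, unique parents force ρ to follow π.
  tree-path-entry : ∀ {t d s y} (π : Path E t d) → AllOn (IsTreeNode N) π → (ρ : Path E s d) →
    Visits E π y → Visits E ρ y ⊎ (Visits E π s × Path E y s)
  tree-path-entry π _ here y∈π = inj₂ (visits-end π , suffix π y∈π)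
  tree-path-entry {t} π π-tree (step {w = s′} s→s′ ρ) y∈π with tree-path-entry π π-tree ρ y∈π
  ... | inj₁ y∈ρ = inj₁ (inj₂ y∈ρ)
  ... | inj₂ (s′∈π , y→s′) with lastEdge y→s′
  ...   | inj₁ refl = inj₁ (inj₂ (visits-start ρ))
  ...   | inj₂ (q , y→q , q→s′ , _) with s′ ≟ t
  ...     | yes refl = ⊥-elim (acyclic _ _ q→s′ (prefix π y∈π ++ₚ y→q))
  ...     | no s′≢t with predecessor-on π s′∈π s′≢t
  ...       | r , r∈π , r→s′ with tree-node-parent-unique (π-tree s′∈π) s→s′ r→s′
                                | tree-node-parent-unique (π-tree s′∈π) q→s′ s→s′
  ...         | refl | refl = inj₂ (r∈π , y→q)

  -- A node w below u that the root reaches avoiding u lies outside u's tree-node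
  -- component: else u lies on the tree path to w from the component's top, and the
  -- root path to w would have to meet it.
  avoiding-outside-component : ∀ {u w} → Path E u w → AvoidingPath E u root w → ¬ SameComp N u w
  avoiding-outside-component {u} u→w (σ , u∉σ) u~w with common-top u~w
  ... | t , (πu , _) , (πw , πw-tree) = u∉σ u∈σ
    where
    u∈πw : Visits E πw u
    u∈πw with tree-path-entry πw πw-tree u→w (visits-start πw)
    ... | inj₂ (u∈πw , _) = u∈πw
    ... | inj₁ t∈u→w with acyclic-antisym acyclic (prefix u→w t∈u→w) πu
    ...   | refl = visits-start πw

    u∈σ : Visits E σ u
    u∈σ with tree-path-entry πw πw-tree σ u∈πw
    ... | inj₁ u∈σ = u∈σ
    ... | inj₂ (_ , u→root) = subst (Visits E σ) (sym (path-into-root u→root)) (visits-start σ)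

-- A parent function (each non-root node sent to one of its parents) determines the
-- spanning tree consisting of the edges par v → v.
module ParentTree {m : ℕ} (N : RPN m) (par : Fin (RPN.n N) → Fin (RPN.n N))
                  (par-edge : ∀ {v} → v ≢ RPN.root N → Edge (RPN.E N) (par v) v) where
  open RPN N

  -- The tree edges, with their characterisation; T is opaque so that Edge T a b is
  -- not unfolded and a, b stay inferable from it.
  opaque
    T : Digraph n
    T a b = does (¬? (b ≟ root) ×-dec (par b ≟ a))

    T-edge⁻ : ∀ {a b} → Edge T a b → b ≢ root × par b ≡ a
    T-edge⁻ {a} {b} e = invert (subst (Reflects _) e (proof (¬? (b ≟ root) ×-dec (par b ≟ a))))

    T-edge⁺ : ∀ {b} → b ≢ root → Edge T (par b) b
    T-edge⁺ {b} b≢root = dec-true (¬? (b ≟ root) ×-dec (par b ≟ par b)) (b≢root , refl)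

  T⊆E : ∀ {a b} → Edge T a b → Edge E a b
  T⊆E e with T-edge⁻ e
  ... | b≢root , refl = par-edge b≢root

  -- Induction up the parent function; it is well founded because N is acyclic.
  parent-induction : (P : Fin n → Set) → P root → (∀ {v} → v ≢ root → P (par v) → P v) → ∀ v → P v
  parent-induction P P-root P-step v = conclude (climb n v)
    where
    -- k parent steps up from v either reach the root, establishing P v, or trace a path of k edges into v
    climb : ∀ k v → P v ⊎ Σ[ w ∈ Fin n ] Σ[ p ∈ Path E w v ] pathLength p ≡ k
    climb zero v = inj₂ (v , here , refl)
    climb (suc k) v with v ≟ root
    ... | yes refl = inj₁ P-root
    ... | no v≢root with climb k (par v)
    ...   | inj₁ P-par = inj₁ (P-step v≢root P-par)
    ...   | inj₂ (w , p , len≡k) =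
            inj₂ (w , snoc p (par-edge v≢root) , trans (pathLength-snoc p _) (cong suc len≡k))

    conclude : P v ⊎ Σ[ w ∈ Fin n ] Σ[ p ∈ Path E w v ] pathLength p ≡ n → P v
    conclude (inj₁ Pv) = Pv
    conclude (inj₂ (_ , p , len≡n)) = ⊥-elim (<-irrefl len≡n (pathLength<n acyclic p))

  spanningTree : SpanningTree N
  spanningTree = record
    { T       = T
    ; T⊆E     = λ _ _ → T⊆E
    ; T-reach = parent-induction (Path T root) here (λ v≢root p → snoc p (T-edge⁺ v≢root))
    ; T-indeg = λ v v≢root → count-one (λ a → T a v) (T-edge⁺ v≢root) (λ e → sym (proj₂ (T-edge⁻ e)))
    }

-- Necessity, for an arbitrary node u: the leaves of a cluster displayed at u lie
-- below u, and a leaf outside it is not dominated by u, since the tree path from the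
-- root to that leaf would pass through u.
displayed⇒conditions : ∀ {m} (N : RPN m) {u S} → DisplayedAt N S u →
  (∀ x → x ∈ S → Below N u (RPN.label N x)) × (∀ x → x ∉ S → ¬ Dominates N u (RPN.label N x))
displayed⇒conditions N {u} {S} (tree , displays) = below , undominated
  where
  open RPN N
  open SpanningTree tree

  T⇒E : ∀ {a b} → Edge T a b → Edge E a b
  T⇒E {a} {b} = T⊆E a b

  below : ∀ x → x ∈ S → Below N u (label x)
  below x x∈S = mapPath T⇒E (proj₁ (displays x) x∈S)

  undominated : ∀ x → x ∉ S → ¬ Dominates N u (label x)
  undominated x x∉S (_ , dominated) = x∉S (proj₂ (displays x) (suffix π u∈π))
    where
    π : Path T root (label x)
    π = T-reach (label x)
    u∈π : Visits T π u
    u∈π = visits-mapPath T⇒E π (dominated (mapPath T⇒E π))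

module Sufficiency {m : ℕ} (N : RPN m) (u : Fin (RPN.n N)) (u-tree : IsTreeNode N u)
                   (exposed : ExposedComponentOf N u) (S : Subset m) where
  open RPN N
  open NetworkFacts N

  -- v is reached from the root avoiding u, i.e. u does not dominate v
  Avoidable : Fin n → Set
  Avoidable = AvoidingPath E u root

  avoidable⇒≢u : ∀ {v} → Avoidable v → v ≢ u
  avoidable⇒≢u (σ , u∉σ) refl = u∉σ (visits-end σ)

  unavoidable⇒dominated : ∀ {v} → ¬ Avoidable v → (p : Path E root v) → Visits E p u
  unavoidable⇒dominated ¬av p with visits? p u
  ... | yes u∈p = u∈p
  ... | no u∉p = ⊥-elim (¬av (p , u∉p))

  avoidable-parent : ∀ {v} → v ≢ root → Avoidable v → Σ[ p ∈ Fin n ] Edge E p v × Avoidable p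
  avoidable-parent v≢root (σ , u∉σ) with lastEdge σ
  ... | inj₁ refl = ⊥-elim (v≢root refl)
  ... | inj₂ (p , σ′ , e , sub) = p , e , σ′ , λ v → u∉σ (sub v)

  avoidable-downward : ∀ {w d} → Path E u w → Avoidable w → Path E w d → Avoidable d
  avoidable-downward u→w (σ , u∉σ) w→d = σ ++ₚ w→d , [ u∉σ , u∉w→d ] ∘ visits-++ σ w→d
    where
    u∉w→d : ¬ Visits E w→d u
    u∉w→d u∈ = avoidable⇒≢u (σ , u∉σ) (acyclic-antisym acyclic (prefix w→d u∈) u→w)

  -- By exposure, an avoidable descendant of u (outside u's component) is a leaf,
  -- an isolated reticulation or redundant, so it has out-degree at most 1.
  thin-below-u : ∀ {d} → Path E u d → Avoidable d → outdeg E d ≤ 1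
  thin-below-u u→d av with exposed u _ (sc-refl u-tree) u→d (avoiding-outside-component u→d av)
  ... | inj₁ (_ , out≡0) = subst (_≤ 1) (sym out≡0) z≤n
  ... | inj₂ (inj₁ ((_ , _ , out≡1) , _)) = ≤-reflexive out≡1
  ... | inj₂ (inj₂ (_ , out≡1)) = ≤-reflexive out≡1

  one-leaf-below : ∀ {w x y} → Path E u w → Avoidable w →
    Path E w (label x) → Path E w (label y) → x ≡ y
  one-leaf-below u→w av w→x w→y =
    label-inj _ _ (sink-unique (λ w→d → thin-below-u (u→w ++ₚ w→d) (avoidable-downward u→w av w→d))
                               w→x w→y (proj₂ (label-leaf _)) (proj₂ (label-leaf _)))

  Feeds : Fin n → Set
  Feeds v = Path E u v × Σ[ x ∈ Fin m ] x ∈ S × Path E v (label x)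

  feeds? : ∀ v → Dec (Feeds v)
  feeds? v = path? E acyclic u v ×-dec any? (λ x → (x ∈? S) ×-dec path? E acyclic v (label x))

  -- The parent chosen for v in the spanning tree: a feeding node other than u
  -- takes a parent below u, and an avoidable non-feeding node an avoidable parent.
  GoodParent : Fin n → Fin n → Set
  GoodParent v p = Edge E p v × (Feeds v → v ≢ u → Path E u p) × (Avoidable v → ¬ Feeds v → Avoidable p)

  good-parent : ∀ {v} → v ≢ root → Σ[ p ∈ Fin n ] GoodParent v p
  good-parent {v} v≢root with feeds? v | v ≟ u
  ... | yes _ | yes v≡u =
        let (p , e) = has-parent v≢root
        in p , e , (λ _ v≢u → ⊥-elim (v≢u v≡u)) , (λ av _ → ⊥-elim (avoidable⇒≢u av v≡u))
  ... | yes feeds | no v≢u with lastEdge (proj₁ feeds)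
  ...   | inj₁ u≡v = ⊥-elim (v≢u (sym u≡v))
  ...   | inj₂ (p , u→p , e , _) = p , e , (λ _ _ → u→p) , (λ _ ¬feeds → ⊥-elim (¬feeds feeds))
  good-parent {v} v≢root | no ¬feeds | _
    with any? (λ p → (E p v ≟ᵇ true) ×-dec avoiding? E acyclic u root p)
  ... | yes (p , e , av) = p , e , (λ feeds → ⊥-elim (¬feeds feeds)) , (λ _ _ → av)
  ... | no none =
        let (p , e) = has-parent v≢root
        in p , e , (λ feeds → ⊥-elim (¬feeds feeds)) ,
           (λ av _ → ⊥-elim (none (avoidable-parent v≢root av)))

  -- the chosen parents as a total function (the root is sent to itself)
  par : Fin n → Fin n
  par v with v ≟ root
  ... | yes _ = root
  ... | no v≢root = proj₁ (good-parent v≢root)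

  par-good : ∀ {v} → v ≢ root → GoodParent v (par v)
  par-good {v} v≢root with v ≟ root
  ... | yes v≡root = ⊥-elim (v≢root v≡root)
  ... | no v≢root′ = proj₂ (good-parent v≢root′)

  open ParentTree N par (λ v≢root → proj₁ (par-good v≢root))

  -- Feeding nodes hang below u in T: climbing by parents keeps feeding until u.
  feeding⇒below-u : ∀ v → Feeds v → Path T u v
  feeding⇒below-u = parent-induction (λ v → Feeds v → Path T u v) at-root climb-up
    where
    at-root : Feeds root → Path T u root
    at-root (u→root , _) = subst (λ a → Path T a root) (sym (path-into-root u→root)) here

    climb-up : ∀ {v} → v ≢ root → (Feeds (par v) → Path T u (par v)) → Feeds v → Path T u v
    climb-up {v} v≢root ih feeds@(_ , y , y∈S , v→y) with v ≟ u
    ... | yes refl = here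
    ... | no v≢u = snoc (ih (below-u feeds v≢u , y , y∈S , step e v→y)) (T-edge⁺ v≢root)
      where
      e = proj₁ (par-good v≢root)
      below-u = proj₁ (proj₂ (par-good v≢root))

  -- On a T-path from a descendant of u to a leaf x outside S, avoidability propagates
  -- upwards: no node on it feeds (it would lie above two leaves), so its parent is avoidable.
  avoidable-upward : ∀ {x a b} → x ∉ S → Path T a b → Path E u a → Avoidable b →
    Path E b (label x) → Avoidable a
  avoidable-upward x∉S here _ av _ = av
  avoidable-upward x∉S (step {w = w} e π) u→a av b→x with T-edge⁻ e
  ... | w≢root , refl = proj₂ (proj₂ (par-good w≢root)) av-w ¬feeds
    where
    u→w : Path E u w
    u→w = snoc u→a (T⊆E e)
    av-w : Avoidable w
    av-w = avoidable-upward x∉S π u→w av b→x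
    ¬feeds : ¬ Feeds w
    ¬feeds (_ , y , y∈S , w→y) =
      x∉S (subst (_∈ S) (one-leaf-below u→w av-w w→y (mapPath T⊆E π ++ₚ b→x)) y∈S)

  conditions⇒displayed :
    (∀ x → x ∈ S → Below N u (label x)) × (∀ x → x ∉ S → ¬ Dominates N u (label x)) →
    DisplayedAt N S u
  conditions⇒displayed (below , undominated) =
    spanningTree , λ x → (λ x∈S → feeding⇒below-u (label x) (below x x∈S , x , x∈S , here)) , in-S x
    where
    -- a leaf x ∉ S below u in T is either avoidable, making u avoidable, or dominated by u
    in-S : ∀ x → Path T u (label x) → x ∈ S
    in-S x u→x with x ∈? S
    ... | yes x∈S = x∈S
    ... | no x∉S with avoiding? E acyclic u root (label x)
    ...   | yes av = ⊥-elim (avoidable⇒≢u (avoidable-upward x∉S u→x here av here) refl)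
    ...   | no ¬av = ⊥-elim (undominated x x∉S (mapPath T⊆E u→x , unavoidable⇒dominated ¬av))

proposition4p1 : ∀ {m} (N : RPN m) (u : Fin (RPN.n N)) →
    IsTreeNode N u → ExposedComponentOf N u → (S : Subset m) →
    DisplayedAt N S u ⇔
      ((∀ x → x ∈ S → Below N u (RPN.label N x))
       × (∀ x → x ∉ S → ¬ Dominates N u (RPN.label N x)))
proposition4p1 N u u-tree exposed S =
  mk⇔ (displayed⇒conditions N) (Sufficiency.conditions⇒displayed N u u-tree exposed S)
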